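{- Let $\Delta=i(n_1,s_1)$ be an insert and $\delta=d(n_2,l_2)$ a delete. If $\Delta\sqsubset\delta$, $\Delta<\delta$ or $\Delta\simeq\delta$, put $\Delta(\delta)=\delta\uparrow\Delta$ and $\delta(\Delta)=\Delta$; if $\Delta\sqsupset\delta$, put $\Delta(\delta)=\delta$ and $\delta(\Delta)=\Delta\uparrow\delta$. Then in each of the cases $\Delta\sqsubset\delta$, $\Delta<\delta$, $\Delta\simeq\delta$, $\Delta\sqsupset\delta$, for every string $t$ to which both $\Delta$ and $\delta$ can be applied, the string obtained from $t$ by applying $\Delta$ and then $\Delta(\delta)$ is defined and equals the string obtained from $t$ by applying $\delta$ and then $\delta(\Delta)$.
   Context: $\Sigma$ is a non-empty finite alphabet; a string is a finite or countably infinite sequence of characters of $\Sigma$, positions being numbered $0,1,2,\dots$, and $|t|$ is its length. A diff is either an insert $i(n,s)$ with $n\in\mathbb{N}$ and $s$ a finite non-empty string, or a delete $d(n,l)$ with $n\in\mathbb{N}$, $l\ge 1$. Applying $i(n,s)$ to $t$ is possible when $n\le|t|$ and yields $t[0..n-1]+s+t[n..]$; applying $d(n,l)$ to $t$ is possible when $n+l\le|t|$ and yields $t$ with the characters at positions $n,\dots,n+l-1$ removed. Endpoints: $\ulcorner i(n,s)=n$, $i(n,s)^{\urcorner}=n+|s|-1$, $\ulcorner d(n,l)=n$, $d(n,l)^{\urcorner}=n+l-1$. Relations between diffs: $\Delta\simeq\delta$ iff $\ulcorner\Delta=\ulcorner\delta$; $\Delta\sqsubset\delta$ iff $\Delta^{\urcorner}<\ulcorner\delta$;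 $\Delta\sqsupset\delta$ iff $\ulcorner\Delta>\delta^{\urcorner}$; $\Delta<\delta$ iff $\ulcorner\Delta<\ulcorner\delta$ and $\Delta^{\urcorner}\ge\ulcorner\delta$. Lifting: for a diff $X$ at position $n_2$ and a diff $Y$ at position $n_1\le n_2$, $X\uparrow Y$ is $X$ with its position changed to $n_2+|s_1|$ if $Y=i(n_1,s_1)$, and to $n_2-l_1$ if $Y=d(n_1,l_1)$ (the string or length of $X$ unchanged). -}

module Defs where

open import Data.Nat using (ℕ; zero; suc; _+_; _∸_; _≤_; _<_; _>_; _≥_; _≤?_; _<?_)
open import Data.Fin using (Fin)
open import Data.List using (List; []; _∷_; length; take; drop; _++_; lookup)
open import Data.List.NonEmpty using (List⁺; toList) renaming (length to length⁺)
open import Data.Maybe using (Maybe; just; nothing; _>>=_)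
open import Data.Unit using (⊤)
open import Data.Empty using (⊥)
open import Relation.Binary.PropositionalEquality using (_≡_)
open import Relation.Nullary using (yes; no)

data Str (A : Set) : Set where
  fin : List A → Str A
  inf : (ℕ → A) → Str A

_≈_ : {A : Set} → Str A → Str A → Set
fin xs ≈ fin ys = xs ≡ ys
inf f  ≈ inf g  = ∀ i → f i ≡ g i
_      ≈ _      = ⊥

_≤len_ : {A : Set} → ℕ → Str A → Set
n ≤len fin xs = n ≤ length xs
n ≤len inf _  = ⊤

data Diff (A : Set) : Set where
  ins : ℕ → List⁺ A → Diff A
  del : (n l : ℕ) → 1 ≤ l → Diff A

Applicable : {A : Set} → Diff A → Str A → Set
Applicable (ins n s) t     = n ≤len t
Applicable (del n l _) t   = (n + l) ≤len t

-- character of a non-empty string s at position i (i < |s| in uses; default to head)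
at⁺ : {A : Set} → List⁺ A → ℕ → A
at⁺ s i with i <? length⁺ s
... | yes p = lookup (toList s) (Data.Fin.fromℕ< {i} (Data.Nat.Properties.≤-trans p (Data.Nat.Properties.≤-refl)))
  where import Data.Fin ; import Data.Nat.Properties
... | no _  = Data.List.NonEmpty.head s
  where import Data.List.NonEmpty

apply : {A : Set} → Diff A → Str A → Maybe (Str A)
apply (ins n s) (fin xs) with n ≤? length xs
... | yes _ = just (fin (take n xs ++ toList s ++ drop n xs))
... | no _  = nothing
apply (ins n s) (inf f) = just (inf g)
  where
  g : ℕ → _
  g i with i <? n
  ... | yes _ = f i
  ... | no _ with i <? n + length⁺ s
  ...   | yes _ = at⁺ s (i ∸ n)
  ...   | no _  = f (i ∸ length⁺ s)
apply (del n l _) (fin xs) with (n + l) ≤? length xs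
... | yes _ = just (fin (take n xs ++ drop (n + l) xs))
... | no _  = nothing
apply (del n l _) (inf f) = just (inf g)
  where
  g : ℕ → _
  g i with i <? n
  ... | yes _ = f i
  ... | no _  = f (i + l)

start : {A : Set} → Diff A → ℕ
start (ins n _)   = n
start (del n _ _) = n

end : {A : Set} → Diff A → ℕ
end (ins n s)   = n + length⁺ s ∸ 1
end (del n l _) = n + l ∸ 1

_≃ᵈ_ : {A : Set} → Diff A → Diff A → Set
Δ ≃ᵈ δ = start Δ ≡ start δ

_⊏_ : {A : Set} → Diff A → Diff A → Set
Δ ⊏ δ = end Δ < start δ

_⊐_ : {A : Set} → Diff A → Diff A → Set
Δ ⊐ δ = start Δ > end δ

_<ᵈ_ : {A : Set} → Diff A → Diff A → Set
Δ <ᵈ δ = (start Δ < start δ) × (end Δ ≥ start δ)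
  where open import Data.Product using (_×_)

-- Lifting X ↑ Y (meaningful when start Y ≤ start X): shift the position of X.
shift : {A : Set} → Diff A → ℕ → Diff A
shift (ins _ s)   m = ins m s
shift (del _ l p) m = del m l p

_↑_ : {A : Set} → Diff A → Diff A → Diff A
X ↑ ins _ s   = shift X (start X + length⁺ s)
X ↑ del _ l _ = shift X (start X ∸ l)

Commutes : {A : Set} → Diff A → Diff A → Diff A → Diff A → Str A → Set
Commutes Δ Δ' δ δ' t =
  Σ (Str _) λ u → Σ (Str _) λ v →
    ((apply Δ t >>= apply Δ') ≡ just u) × ((apply δ t >>= apply δ') ≡ just v) × (u ≈ v)
  where open import Data.Product using (Σ; _×_)

module Submission where

-- The four relations between Δ and δ only matter through the relative position
-- of the two edits, so the proof first reduces them to arithmetic: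
--   Δ ⊏ δ, Δ <ᵈ δ or Δ ≃ᵈ δ  give  n₁ ≤ n₂        (the insert comes first),
--   Δ ⊐ δ                     gives  n₂ + l ≤ n₁   (the insert lies past the
--                                                   deleted block).
-- In the first situation the delete must be shifted right by |s| once the insert
-- is done; in the second the insert must be shifted left by l once the delete is
-- done.  Both commutation facts are then proved for each kind of string:
--   * finite strings, by induction on the list and the positions, after naming
--     the list operations that `apply` performs;
--   * infinite strings, pointwise, by splitting the index into the at most four
--     ranges on which both composites have a fixed closed form.

open import Defs
open import Data.Nat using (ℕ; suc; zero; _≤_; _<_; _+_; _∸_; _≤?_; _<?_; s≤s; z≤n)
open import Data.Nat.Properties
open import Algebra.Properties.CommutativeSemigroup +-commutativeSemigroup using (xy∙z≈xz∙y)
open import Data.Fin using (Fin)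
open import Data.List using (List; []; _∷_; length; take; drop; _++_)
open import Data.List.Properties using (length-++)
open import Data.List.NonEmpty using (List⁺; toList) renaming (length to length⁺)
open import Data.Maybe using (Maybe; just; _>>=_)
open import Data.Product using (_×_; _,_; proj₁)
open import Data.Sum using (_⊎_; inj₁; inj₂)
open import Data.Empty using (⊥-elim)
open import Relation.Nullary using (yes; no)
open import Relation.Binary.PropositionalEquality
open ≡-Reasoning

∸1<⇒≤ : ∀ {m n} → 1 ≤ m → m ∸ 1 < n → m ≤ n
∸1<⇒≤ {suc m} _ m<n = m<n

∸-<-shift : ∀ {i n L} → L ≤ i → i < n + L → i ∸ L < n
∸-<-shift {i} {n} {L} L≤i i<n+L =
  subst (i ∸ L <_) (m+n∸n≡m n L) (∸-monoˡ-< i<n+L L≤i)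

module _ {A : Set} (n₁ : ℕ) (s : List⁺ A) (n₂ l : ℕ) (p : 1 ≤ l) where

  insert-first : ins n₁ s ⊏ del n₂ l p ⊎ ins n₁ s <ᵈ del n₂ l p ⊎ ins n₁ s ≃ᵈ del n₂ l p →
                 n₁ ≤ n₂
  insert-first (inj₁ Δ⊏δ)        = m+n≤o⇒m≤o n₁ (∸1<⇒≤ (≤-trans (s≤s z≤n) (m≤n+m (length⁺ s) n₁)) Δ⊏δ)
  insert-first (inj₂ (inj₁ Δ<δ)) = <⇒≤ (proj₁ Δ<δ)
  insert-first (inj₂ (inj₂ Δ≃δ)) = ≤-reflexive Δ≃δ

  insert-past-block : ins n₁ s ⊐ del n₂ l p → n₂ + l ≤ n₁
  insert-past-block = ∸1<⇒≤ (≤-trans p (m≤n+m l n₂))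

commutes-intro : ∀ {A : Set} (Δ Δ' δ δ' : Diff A) (t : Str A) {u₁ u v₁ v : Str A} →
  apply Δ t ≡ just u₁ → apply Δ' u₁ ≡ just u →
  apply δ t ≡ just v₁ → apply δ' v₁ ≡ just v →
  u ≈ v → Commutes Δ Δ' δ δ' t
commutes-intro Δ Δ' δ δ' t {u = u} {v = v} Δt Δ'u₁ δt δ'v₁ u≈v =
  u , v , trans (cong (_>>= apply Δ') Δt) Δ'u₁ , trans (cong (_>>= apply δ') δt) δ'v₁ , u≈v

module _ {A : Set} where

  insL : ℕ → List⁺ A → List A → List A
  insL n s xs = take n xs ++ toList s ++ drop n xs

  delL : ℕ → ℕ → List A → List A
  delL n l xs = take n xs ++ drop (n + l) xs

  apply-ins-fin : ∀ n s xs → n ≤ length xs → apply (ins n s) (fin xs) ≡ just (fin (insL n s xs))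
  apply-ins-fin n s xs n≤ with n ≤? length xs
  ... | yes _ = refl
  ... | no n≰ = ⊥-elim (n≰ n≤)

  apply-del-fin : ∀ n l (p : 1 ≤ l) xs → n + l ≤ length xs →
                  apply (del n l p) (fin xs) ≡ just (fin (delL n l xs))
  apply-del-fin n l p xs n+l≤ with (n + l) ≤? length xs
  ... | yes _ = refl
  ... | no n+l≰ = ⊥-elim (n+l≰ n+l≤)

  length-insL : ∀ n s xs → n ≤ length xs → length (insL n s xs) ≡ length⁺ s + length xs
  length-insL zero s xs _ = length-++ (toList s)
  length-insL (suc n) s (x ∷ xs) (s≤s n≤) =
    trans (cong suc (length-insL n s xs n≤)) (sym (+-suc (length⁺ s) (length xs)))

  length-delL : ∀ n l xs → n + l ≤ length xs → length (delL n l xs) + l ≡ length xs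
  length-delL zero zero xs _ = +-identityʳ (length xs)
  length-delL zero (suc l) (x ∷ xs) (s≤s l≤) = trans (+-suc _ l) (cong suc (length-delL zero l xs l≤))
  length-delL (suc n) l (x ∷ xs) (s≤s n+l≤) = cong suc (length-delL n l xs n+l≤)

  delL-++ : ∀ (ps xs : List A) n l → delL (length ps + n) l (ps ++ xs) ≡ ps ++ delL n l xs
  delL-++ [] xs n l = refl
  delL-++ (x ∷ ps) xs n l = cong (x ∷_) (delL-++ ps xs n l)

  drop-insL : ∀ m l s xs → l ≤ m → m ≤ length xs → drop l (insL m s xs) ≡ insL (m ∸ l) s (drop l xs)
  drop-insL m zero s xs _ _ = refl
  drop-insL (suc m) (suc l) s (x ∷ xs) (s≤s l≤m) (s≤s m≤) = drop-insL m l s xs l≤m m≤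

  delL-insL-before : ∀ n₁ n₂ l s xs → n₁ ≤ n₂ → n₁ ≤ length xs →
    delL (n₂ + length⁺ s) l (insL n₁ s xs) ≡ insL n₁ s (delL n₂ l xs)
  delL-insL-before zero n₂ l s xs _ _ = begin
    delL (n₂ + length⁺ s) l (toList s ++ xs) ≡⟨ cong (λ k → delL k l (toList s ++ xs)) (+-comm n₂ _) ⟩
    delL (length⁺ s + n₂) l (toList s ++ xs) ≡⟨ delL-++ (toList s) xs n₂ l ⟩
    toList s ++ delL n₂ l xs                 ∎
  delL-insL-before (suc n₁) (suc n₂) l s (x ∷ xs) (s≤s n₁≤n₂) (s≤s n₁≤) =
    cong (x ∷_) (delL-insL-before n₁ n₂ l s xs n₁≤n₂ n₁≤)

  delL-insL-after : ∀ m n₂ l s xs → n₂ ≤ m → m + l ≤ length xs →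
    delL n₂ l (insL (m + l) s xs) ≡ insL m s (delL n₂ l xs)
  delL-insL-after m zero l s xs _ m+l≤ = begin
    drop l (insL (m + l) s xs)     ≡⟨ drop-insL (m + l) l s xs (m≤n+m l m) m+l≤ ⟩
    insL (m + l ∸ l) s (drop l xs) ≡⟨ cong (λ k → insL k s (drop l xs)) (m+n∸n≡m m l) ⟩
    insL m s (drop l xs)           ∎
  delL-insL-after (suc m) (suc n₂) l s (x ∷ xs) (s≤s n₂≤m) (s≤s m+l≤) =
    cong (x ∷_) (delL-insL-after m n₂ l s xs n₂≤m m+l≤)

module _ {A : Set} where

  -- The characters of the result of applying a diff to an infinite string
  -- (`apply` always succeeds there; the fallback f is never reached).
  chars : (ℕ → A) → Maybe (Str A) → ℕ → A
  chars f (just (inf g)) = g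
  chars f _              = f

  insI : ℕ → List⁺ A → (ℕ → A) → ℕ → A
  insI n s f = chars f (apply (ins n s) (inf f))

  delI : (n l : ℕ) → 1 ≤ l → (ℕ → A) → ℕ → A
  delI n l p f = chars f (apply (del n l p) (inf f))

  insI-below : ∀ n s f {i} → i < n → insI n s f i ≡ f i
  insI-below n s f {i} i<n with i <? n
  ... | yes _ = refl
  ... | no i≮n = ⊥-elim (i≮n i<n)

  insI-inside : ∀ n s f {i} → n ≤ i → i < n + length⁺ s → insI n s f i ≡ at⁺ s (i ∸ n)
  insI-inside n s f {i} n≤i i<n+L with i <? n
  ... | yes i<n = ⊥-elim (<⇒≱ i<n n≤i)
  ... | no _ with i <? n + length⁺ s
  ...   | yes _ = refl
  ...   | no i≮n+L = ⊥-elim (i≮n+L i<n+L)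

  insI-above : ∀ n s f {i} → n + length⁺ s ≤ i → insI n s f i ≡ f (i ∸ length⁺ s)
  insI-above n s f {i} n+L≤i with i <? n
  ... | yes i<n = ⊥-elim (<⇒≱ i<n (m+n≤o⇒m≤o n n+L≤i))
  ... | no _ with i <? n + length⁺ s
  ...   | yes i<n+L = ⊥-elim (<⇒≱ i<n+L n+L≤i)
  ...   | no _ = refl

  delI-below : ∀ n l p f {i} → i < n → delI n l p f i ≡ f i
  delI-below n l p f {i} i<n with i <? n
  ... | yes _ = refl
  ... | no i≮n = ⊥-elim (i≮n i<n)

  delI-above : ∀ n l p f {i} → n ≤ i → delI n l p f i ≡ f (i + l)
  delI-above n l p f {i} n≤i with i <? n
  ... | yes i<n = ⊥-elim (<⇒≱ i<n n≤i)
  ... | no _ = refl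

  delI-insI-before : ∀ n₁ n₂ l p s f → n₁ ≤ n₂ → ∀ i →
    delI (n₂ + length⁺ s) l p (insI n₁ s f) i ≡ insI n₁ s (delI n₂ l p f) i
  delI-insI-before n₁ n₂ l p s f n₁≤n₂ i with ≤-<-connex n₁ i
  ... | inj₂ i<n₁ = begin
    delI (n₂ + L) l p (insI n₁ s f) i ≡⟨ delI-below _ l p _ (<-≤-trans i<n₁ (≤-trans n₁≤n₂ (m≤m+n n₂ L))) ⟩
    insI n₁ s f i                     ≡⟨ insI-below n₁ s f i<n₁ ⟩
    f i                               ≡⟨ delI-below n₂ l p f (<-≤-trans i<n₁ n₁≤n₂) ⟨
    delI n₂ l p f i                   ≡⟨ insI-below n₁ s _ i<n₁ ⟨
    insI n₁ s (delI n₂ l p f) i       ∎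
    where L = length⁺ s
  ... | inj₁ n₁≤i with ≤-<-connex (n₁ + length⁺ s) i
  ...   | inj₂ i<n₁+L = begin
    delI (n₂ + L) l p (insI n₁ s f) i ≡⟨ delI-below _ l p _ (<-≤-trans i<n₁+L (+-monoˡ-≤ L n₁≤n₂)) ⟩
    insI n₁ s f i                     ≡⟨ insI-inside n₁ s f n₁≤i i<n₁+L ⟩
    at⁺ s (i ∸ n₁)                    ≡⟨ insI-inside n₁ s _ n₁≤i i<n₁+L ⟨
    insI n₁ s (delI n₂ l p f) i       ∎
    where L = length⁺ s
  ...   | inj₁ n₁+L≤i with ≤-<-connex (n₂ + length⁺ s) i
  ...     | inj₂ i<n₂+L = begin
    delI (n₂ + L) l p (insI n₁ s f) i ≡⟨ delI-below _ l p _ i<n₂+L ⟩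
    insI n₁ s f i                     ≡⟨ insI-above n₁ s f n₁+L≤i ⟩
    f (i ∸ L)                         ≡⟨ delI-below n₂ l p f (∸-<-shift (m+n≤o⇒n≤o n₁ n₁+L≤i) i<n₂+L) ⟨
    delI n₂ l p f (i ∸ L)             ≡⟨ insI-above n₁ s _ n₁+L≤i ⟨
    insI n₁ s (delI n₂ l p f) i       ∎
    where L = length⁺ s
  ...     | inj₁ n₂+L≤i = begin
    delI (n₂ + L) l p (insI n₁ s f) i ≡⟨ delI-above _ l p _ n₂+L≤i ⟩
    insI n₁ s f (i + l)               ≡⟨ insI-above n₁ s f (≤-trans n₁+L≤i (m≤m+n i l)) ⟩
    f (i + l ∸ L)                     ≡⟨ cong f (+-∸-comm l (m+n≤o⇒n≤o n₁ n₁+L≤i)) ⟩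
    f (i ∸ L + l)                     ≡⟨ delI-above n₂ l p f (m+n≤o⇒m≤o∸n n₂ n₂+L≤i) ⟨
    delI n₂ l p f (i ∸ L)             ≡⟨ insI-above n₁ s _ n₁+L≤i ⟨
    insI n₁ s (delI n₂ l p f) i       ∎
    where L = length⁺ s

  delI-insI-after : ∀ m n₂ l p s f → n₂ ≤ m → ∀ i →
    delI n₂ l p (insI (m + l) s f) i ≡ insI m s (delI n₂ l p f) i
  delI-insI-after m n₂ l p s f n₂≤m i with ≤-<-connex n₂ i
  ... | inj₂ i<n₂ = begin
    delI n₂ l p (insI (m + l) s f) i ≡⟨ delI-below n₂ l p _ i<n₂ ⟩
    insI (m + l) s f i               ≡⟨ insI-below (m + l) s f (<-≤-trans i<n₂ (≤-trans n₂≤m (m≤m+n m l))) ⟩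
    f i                              ≡⟨ delI-below n₂ l p f i<n₂ ⟨
    delI n₂ l p f i                  ≡⟨ insI-below m s _ (<-≤-trans i<n₂ n₂≤m) ⟨
    insI m s (delI n₂ l p f) i       ∎
  ... | inj₁ n₂≤i with ≤-<-connex m i
  ...   | inj₂ i<m = begin
    delI n₂ l p (insI (m + l) s f) i ≡⟨ delI-above n₂ l p _ n₂≤i ⟩
    insI (m + l) s f (i + l)         ≡⟨ insI-below (m + l) s f (+-monoˡ-< l i<m) ⟩
    f (i + l)                        ≡⟨ delI-above n₂ l p f n₂≤i ⟨
    delI n₂ l p f i                  ≡⟨ insI-below m s _ i<m ⟨
    insI m s (delI n₂ l p f) i       ∎
  ...   | inj₁ m≤i with ≤-<-connex (m + length⁺ s) i
  ...     | inj₂ i<m+L = begin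
    delI n₂ l p (insI (m + l) s f) i ≡⟨ delI-above n₂ l p _ n₂≤i ⟩
    insI (m + l) s f (i + l)         ≡⟨ insI-inside (m + l) s f (+-monoˡ-≤ l m≤i)
                                          (subst (i + l <_) (xy∙z≈xz∙y m L l) (+-monoˡ-< l i<m+L)) ⟩
    at⁺ s (i + l ∸ (m + l))          ≡⟨ cong (at⁺ s) (cancel-∸ʳ i m) ⟩
    at⁺ s (i ∸ m)                    ≡⟨ insI-inside m s _ m≤i i<m+L ⟨
    insI m s (delI n₂ l p f) i       ∎
    where
    L = length⁺ s
    cancel-∸ʳ : ∀ a b → a + l ∸ (b + l) ≡ a ∸ b
    cancel-∸ʳ a b = trans (cong₂ _∸_ (+-comm a l) (+-comm b l)) ([m+n]∸[m+o]≡n∸o l a b)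
  ...     | inj₁ m+L≤i = begin
    delI n₂ l p (insI (m + l) s f) i ≡⟨ delI-above n₂ l p _ n₂≤i ⟩
    insI (m + l) s f (i + l)         ≡⟨ insI-above (m + l) s f
                                          (subst (_≤ i + l) (xy∙z≈xz∙y m L l) (+-monoˡ-≤ l m+L≤i)) ⟩
    f (i + l ∸ L)                    ≡⟨ cong f (+-∸-comm l (m+n≤o⇒n≤o m m+L≤i)) ⟩
    f (i ∸ L + l)                    ≡⟨ delI-above n₂ l p f (≤-trans n₂≤m (m+n≤o⇒m≤o∸n m m+L≤i)) ⟨
    delI n₂ l p f (i ∸ L)            ≡⟨ insI-above m s _ m+L≤i ⟨
    insI m s (delI n₂ l p f) i       ∎
    where L = length⁺ s

module _ {A : Set} (s : List⁺ A) (l : ℕ) (p : 1 ≤ l) where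

  commute-insert-first : ∀ n₁ n₂ → n₁ ≤ n₂ → (t : Str A) →
    Applicable (ins n₁ s) t → Applicable (del n₂ l p) t →
    Commutes (ins n₁ s) (del (n₂ + length⁺ s) l p) (del n₂ l p) (ins n₁ s) t
  commute-insert-first n₁ n₂ n₁≤n₂ (fin xs) n₁≤ n₂+l≤ =
    commutes-intro (ins n₁ s) (del (n₂ + L) l p) (del n₂ l p) (ins n₁ s) (fin xs)
                   (apply-ins-fin n₁ s xs n₁≤) (apply-del-fin _ l p _ deletable)
                   (apply-del-fin n₂ l p xs n₂+l≤) (apply-ins-fin n₁ s _ insertable)
                   (delL-insL-before n₁ n₂ l s xs n₁≤n₂ n₁≤)
    where
    L = length⁺ s
    deletable : n₂ + L + l ≤ length (insL n₁ s xs)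
    deletable = subst₂ _≤_ (sym (xy∙z≈xz∙y n₂ L l))
                  (trans (+-comm (length xs) L) (sym (length-insL n₁ s xs n₁≤)))
                  (+-monoˡ-≤ L n₂+l≤)
    insertable : n₁ ≤ length (delL n₂ l xs)
    insertable = ≤-trans n₁≤n₂
      (+-cancelʳ-≤ l n₂ _ (subst (n₂ + l ≤_) (sym (length-delL n₂ l xs n₂+l≤)) n₂+l≤))
  commute-insert-first n₁ n₂ n₁≤n₂ (inf f) _ _ =
    commutes-intro (ins n₁ s) (del (n₂ + length⁺ s) l p) (del n₂ l p) (ins n₁ s) (inf f)
                   refl refl refl refl (delI-insI-before n₁ n₂ l p s f n₁≤n₂)

  commute-insert-after : ∀ m n₂ → n₂ ≤ m → (t : Str A) →
    Applicable (ins (m + l) s) t → Applicable (del n₂ l p) t →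
    Commutes (ins (m + l) s) (del n₂ l p) (del n₂ l p) (ins m s) t
  commute-insert-after m n₂ n₂≤m (fin xs) m+l≤ n₂+l≤ =
    commutes-intro (ins (m + l) s) (del n₂ l p) (del n₂ l p) (ins m s) (fin xs)
                   (apply-ins-fin (m + l) s xs m+l≤) (apply-del-fin n₂ l p _ deletable)
                   (apply-del-fin n₂ l p xs n₂+l≤) (apply-ins-fin m s _ insertable)
                   (delL-insL-after m n₂ l s xs n₂≤m m+l≤)
    where
    deletable : n₂ + l ≤ length (insL (m + l) s xs)
    deletable = subst (n₂ + l ≤_) (sym (length-insL (m + l) s xs m+l≤))
                  (≤-trans n₂+l≤ (m≤n+m (length xs) (length⁺ s)))
    insertable : m ≤ length (delL n₂ l xs)
    insertable = +-cancelʳ-≤ l m _ (subst (m + l ≤_) (sym (length-delL n₂ l xs n₂+l≤)) m+l≤)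
  commute-insert-after m n₂ n₂≤m (inf f) _ _ =
    commutes-intro (ins (m + l) s) (del n₂ l p) (del n₂ l p) (ins m s) (inf f)
                   refl refl refl refl (delI-insI-after m n₂ l p s f n₂≤m)

  -- The same for an insert at any n₁ past the block: write n₁ = (n₁ ∸ l) + l.
  commute-insert-past-block : ∀ n₁ n₂ → n₂ + l ≤ n₁ → (t : Str A) →
    Applicable (ins n₁ s) t → Applicable (del n₂ l p) t →
    Commutes (ins n₁ s) (del n₂ l p) (del n₂ l p) (ins (n₁ ∸ l) s) t
  commute-insert-past-block n₁ n₂ n₂+l≤n₁ t =
    subst (λ n → Applicable (ins n s) t → Applicable (del n₂ l p) t →
                 Commutes (ins n s) (del n₂ l p) (del n₂ l p) (ins (n₁ ∸ l) s) t)
          (m∸n+n≡m (m+n≤o⇒n≤o n₂ n₂+l≤n₁))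
          (commute-insert-after (n₁ ∸ l) n₂ (m+n≤o⇒m≤o∸n n₂ n₂+l≤n₁) t)

mainTheorem3 : (k : ℕ) (n₁ : ℕ) (s₁ : List⁺ (Fin (suc k))) (n₂ l₂ : ℕ) (p : 1 ≤ l₂) →
    ((ins n₁ s₁ ⊏ del n₂ l₂ p ⊎ ins n₁ s₁ <ᵈ del n₂ l₂ p ⊎ ins n₁ s₁ ≃ᵈ del n₂ l₂ p) →
       (t : Str (Fin (suc k))) → Applicable (ins n₁ s₁) t → Applicable (del n₂ l₂ p) t →
       Commutes (ins n₁ s₁) (del n₂ l₂ p ↑ ins n₁ s₁) (del n₂ l₂ p) (ins n₁ s₁) t)
    × (ins n₁ s₁ ⊐ del n₂ l₂ p →
       (t : Str (Fin (suc k))) → Applicable (ins n₁ s₁) t → Applicable (del n₂ l₂ p) t →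
       Commutes (ins n₁ s₁) (del n₂ l₂ p) (del n₂ l₂ p) (ins n₁ s₁ ↑ del n₂ l₂ p) t)
mainTheorem3 k n₁ s n₂ l p =
    (λ rel → commute-insert-first s l p n₁ n₂ (insert-first n₁ s n₂ l p rel))
  , (λ rel → commute-insert-past-block s l p n₁ n₂ (insert-past-block n₁ s n₂ l p rel))
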